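{- The class of radical-dense residuated lattices is closed under subalgebras and direct products.
   Context: A residuated lattice is a commutative integral residuated bounded lattice $(A,\vee,\wedge,\odot,\rightarrow,0,1)$ (bounded lattice, commutative monoid $(A,\odot,1)$, $a\le b\rightarrow c$ iff $a\odot b\le c$); $\neg a:=a\rightarrow 0$. A filter is a nonempty subset closed under $\odot$ and upward closed; ${\rm Rad}(A)$ is the intersection of all maximal filters of $A$ (for the trivial algebra, ${\rm Rad}$ is the whole algebra). $Ds(A)=\{a\in A\mid\neg a=0\}$. $A$ is radical-dense iff ${\rm Rad}(A)=Ds(A)$. -}

module Defs where

open import Level using (Level; _⊔_; suc)
open import Data.Product using (Σ; ∃; _×_; _,_; proj₁; proj₂)
open import Relation.Nullary using (¬_)
open import Relation.Binary.Core using (Rel)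
open import Relation.Binary.Structures using (IsEquivalence)
open import Algebra.Core using (Op₂)
open import Algebra.Structures using (IsCommutativeMonoid; IsMonoid; IsSemigroup; IsMagma)
open import Algebra.Lattice.Structures using (IsLattice)

record ResiduatedLattice (c ℓ : Level) : Set (suc (c ⊔ ℓ)) where
  infix  4 _≈_ _≤_
  infixr 6 _∨_
  infixr 7 _∧_ _⊙_
  infixr 5 _⇒_
  field
    Carrier : Set c
    _≈_     : Rel Carrier ℓ
    _∨_     : Op₂ Carrier
    _∧_     : Op₂ Carrier
    _⊙_     : Op₂ Carrier
    _⇒_     : Op₂ Carrier
    0#      : Carrier
    1#      : Carrier
    isLattice           : IsLattice _≈_ _∨_ _∧_
    ⊙-isCommutativeMonoid : IsCommutativeMonoid _≈_ _⊙_ 1#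
    ⇒-cong  : ∀ {x x′ y y′} → x ≈ x′ → y ≈ y′ → (x ⇒ y) ≈ (x′ ⇒ y′)

  _≤_ : Rel Carrier ℓ
  x ≤ y = (x ∧ y) ≈ x

  field
    0-least    : ∀ x → 0# ≤ x
    1-greatest : ∀ x → x ≤ 1#
    residuation₁ : ∀ a b c → a ≤ (b ⇒ c) → (a ⊙ b) ≤ c
    residuation₂ : ∀ a b c → (a ⊙ b) ≤ c → a ≤ (b ⇒ c)

  ¬′_ : Carrier → Carrier
  ¬′ a = a ⇒ 0#

  open IsLattice isLattice public
    using (isEquivalence; ∨-comm; ∨-assoc; ∨-cong; ∧-comm; ∧-assoc; ∧-cong; absorptive)

module _ {c ℓ : Level} (A : ResiduatedLattice c ℓ) where
  open ResiduatedLattice A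

  Subset : Set (suc (c ⊔ ℓ))
  Subset = Carrier → Set (c ⊔ ℓ)

  _⊆_ : Subset → Subset → Set (c ⊔ ℓ)
  F ⊆ G = ∀ x → F x → G x

  record IsFilter (F : Subset) : Set (c ⊔ ℓ) where
    field
      nonempty   : ∃ F
      ⊙-closed   : ∀ x y → F x → F y → F (x ⊙ y)
      up-closed  : ∀ x y → F x → x ≤ y → F y

  IsProper : Subset → Set (c ⊔ ℓ)
  IsProper F = ¬ F 0#

  record IsMaximalFilter (F : Subset) : Set (suc (c ⊔ ℓ)) where
    field
      filter  : IsFilter F
      proper  : IsProper F
      maximal : ∀ G → IsFilter G → IsProper G → F ⊆ G → G ⊆ F

  Rad : Carrier → Set (suc (c ⊔ ℓ))
  Rad a = ∀ F → IsMaximalFilter F → F a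

  Ds : Carrier → Set ℓ
  Ds a = (¬′ a) ≈ 0#

  RadicalDense : Set (suc (c ⊔ ℓ))
  RadicalDense = (∀ a → Rad a → Ds a) × (∀ a → Ds a → Rad a)

record Subalgebra {c ℓ : Level} (s : Level) (A : ResiduatedLattice c ℓ) : Set (c ⊔ ℓ ⊔ suc s) where
  open ResiduatedLattice A
  field
    S    : Carrier → Set s
    0∈S  : S 0#
    1∈S  : S 1#
    ∨∈S  : ∀ {x y} → S x → S y → S (x ∨ y)
    ∧∈S  : ∀ {x y} → S x → S y → S (x ∧ y)
    ⊙∈S  : ∀ {x y} → S x → S y → S (x ⊙ y)
    ⇒∈S  : ∀ {x y} → S x → S y → S (x ⇒ y)

subalgebra : ∀ {c ℓ s} (A : ResiduatedLattice c ℓ) → Subalgebra s A → ResiduatedLattice (c ⊔ s) ℓ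
subalgebra A B = record
  { Carrier = Σ Carrier S
  ; _≈_ = λ x y → proj₁ x ≈ proj₁ y
  ; _∨_ = λ x y → (proj₁ x ∨ proj₁ y) , ∨∈S (proj₂ x) (proj₂ y)
  ; _∧_ = λ x y → (proj₁ x ∧ proj₁ y) , ∧∈S (proj₂ x) (proj₂ y)
  ; _⊙_ = λ x y → (proj₁ x ⊙ proj₁ y) , ⊙∈S (proj₂ x) (proj₂ y)
  ; _⇒_ = λ x y → (proj₁ x ⇒ proj₁ y) , ⇒∈S (proj₂ x) (proj₂ y)
  ; 0# = 0# , 0∈S
  ; 1# = 1# , 1∈S
  ; isLattice = record
    { isEquivalence = record { refl = E.refl ; sym = E.sym ; trans = E.trans }
    ; ∨-comm = λ x y → ∨-comm (proj₁ x) (proj₁ y)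
    ; ∨-assoc = λ x y z → ∨-assoc (proj₁ x) (proj₁ y) (proj₁ z)
    ; ∨-cong = ∨-cong
    ; ∧-comm = λ x y → ∧-comm (proj₁ x) (proj₁ y)
    ; ∧-assoc = λ x y z → ∧-assoc (proj₁ x) (proj₁ y) (proj₁ z)
    ; ∧-cong = ∧-cong
    ; absorptive = (λ x y → proj₁ absorptive (proj₁ x) (proj₁ y))
                 , (λ x y → proj₂ absorptive (proj₁ x) (proj₁ y))
    }
  ; ⊙-isCommutativeMonoid = record
    { isMonoid = record
      { isSemigroup = record
        { isMagma = record
          { isEquivalence = record { refl = E.refl ; sym = E.sym ; trans = E.trans }
          ; ∙-cong = M.∙-cong }
        ; assoc = λ x y z → M.assoc (proj₁ x) (proj₁ y) (proj₁ z) }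
      ; identity = (λ x → proj₁ M.identity (proj₁ x)) , (λ x → proj₂ M.identity (proj₁ x)) }
    ; comm = λ x y → M.comm (proj₁ x) (proj₁ y) }
  ; ⇒-cong = ⇒-cong
  ; 0-least = λ x → 0-least (proj₁ x)
  ; 1-greatest = λ x → 1-greatest (proj₁ x)
  ; residuation₁ = λ a b c → residuation₁ (proj₁ a) (proj₁ b) (proj₁ c)
  ; residuation₂ = λ a b c → residuation₂ (proj₁ a) (proj₁ b) (proj₁ c)
  }
  where
    open ResiduatedLattice A
    open Subalgebra B
    module E = IsEquivalence isEquivalence
    module M = IsCommutativeMonoid ⊙-isCommutativeMonoid

product : ∀ {i c ℓ} (I : Set i) → (I → ResiduatedLattice c ℓ) → ResiduatedLattice (i ⊔ c) (i ⊔ ℓ)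
product I A = record
  { Carrier = ∀ j → C j
  ; _≈_ = λ x y → ∀ j → EQ j (x j) (y j)
  ; _∨_ = λ x y j → ResiduatedLattice._∨_ (A j) (x j) (y j)
  ; _∧_ = λ x y j → ResiduatedLattice._∧_ (A j) (x j) (y j)
  ; _⊙_ = λ x y j → ResiduatedLattice._⊙_ (A j) (x j) (y j)
  ; _⇒_ = λ x y j → ResiduatedLattice._⇒_ (A j) (x j) (y j)
  ; 0# = λ j → ResiduatedLattice.0# (A j)
  ; 1# = λ j → ResiduatedLattice.1# (A j)
  ; isLattice = record
    { isEquivalence = eqv
    ; ∨-comm = λ x y j → ResiduatedLattice.∨-comm (A j) (x j) (y j)
    ; ∨-assoc = λ x y z j → ResiduatedLattice.∨-assoc (A j) (x j) (y j) (z j)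
    ; ∨-cong = λ p q j → ResiduatedLattice.∨-cong (A j) (p j) (q j)
    ; ∧-comm = λ x y j → ResiduatedLattice.∧-comm (A j) (x j) (y j)
    ; ∧-assoc = λ x y z j → ResiduatedLattice.∧-assoc (A j) (x j) (y j) (z j)
    ; ∧-cong = λ p q j → ResiduatedLattice.∧-cong (A j) (p j) (q j)
    ; absorptive = (λ x y j → proj₁ (ResiduatedLattice.absorptive (A j)) (x j) (y j))
                 , (λ x y j → proj₂ (ResiduatedLattice.absorptive (A j)) (x j) (y j))
    }
  ; ⊙-isCommutativeMonoid = record
    { isMonoid = record
      { isSemigroup = record
        { isMagma = record
          { isEquivalence = eqv
          ; ∙-cong = λ p q j → IsCommutativeMonoid.∙-cong (M j) (p j) (q j) }
        ; assoc = λ x y z j → IsCommutativeMonoid.assoc (M j) (x j) (y j) (z j) }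
      ; identity = (λ x j → proj₁ (IsCommutativeMonoid.identity (M j)) (x j))
                 , (λ x j → proj₂ (IsCommutativeMonoid.identity (M j)) (x j)) }
    ; comm = λ x y j → IsCommutativeMonoid.comm (M j) (x j) (y j) }
  ; ⇒-cong = λ p q j → ResiduatedLattice.⇒-cong (A j) (p j) (q j)
  ; 0-least = λ x j → ResiduatedLattice.0-least (A j) (x j)
  ; 1-greatest = λ x j → ResiduatedLattice.1-greatest (A j) (x j)
  ; residuation₁ = λ a b c p j → ResiduatedLattice.residuation₁ (A j) (a j) (b j) (c j) (p j)
  ; residuation₂ = λ a b c p j → ResiduatedLattice.residuation₂ (A j) (a j) (b j) (c j) (p j)
  }
  where
    C : I → Set _
    C j = ResiduatedLattice.Carrier (A j)
    EQ : (j : I) → Rel (C j) _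
    EQ j = ResiduatedLattice._≈_ (A j)
    M : (j : I) → IsCommutativeMonoid (EQ j) _ _
    M j = ResiduatedLattice.⊙-isCommutativeMonoid (A j)
    module E (j : I) = IsEquivalence (ResiduatedLattice.isEquivalence (A j))
    eqv : IsEquivalence (λ (x y : ∀ j → C j) → ∀ j → EQ j (x j) (y j))
    eqv = record { refl = λ j → E.refl j ; sym = λ p j → E.sym j (p j)
                 ; trans = λ p q j → E.trans j (p j) (q j) }

-- Ds(A) ⊆ Rad(A) in every residuated lattice: if ¬x = 0 then every power of x is
-- dense, so extending a maximal filter by x keeps it proper, and maximality puts x in it.
-- For Rad ⊆ Ds it suffices that A maps into radical-dense algebras Bⱼ by jointly
-- injective homomorphisms hⱼ, as a subalgebra does into its ambient algebra and a
-- product into its factors: preimages of maximal filters are maximal, so hⱼ sends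
-- Rad(A) into Rad(Bⱼ) = Ds(Bⱼ), and ¬x = 0 is reflected by the hⱼ.
module Submission where

open import Level using (Level; Lift; lift; lower; _⊔_)
open import Data.Empty using (⊥)
open import Data.Nat using (ℕ; zero; suc; _+_)
open import Data.Product using (_×_; _,_; proj₁; proj₂; ∃₂)
open import Data.Unit using (⊤; tt)
open import Algebra.Bundles using (CommutativeMonoid)
open import Algebra.Lattice.Bundles using (Lattice)
open import Relation.Binary.Bundles using (Poset)
open import Relation.Binary.Structures using (IsEquivalence)
open import Defs

module Properties {c ℓ : Level} (A : ResiduatedLattice c ℓ) where
  open ResiduatedLattice A
  open IsEquivalence isEquivalence using (refl; sym; trans)

  lattice : Lattice c ℓ
  lattice = record { isLattice = isLattice }

  ⊙-commutativeMonoid : CommutativeMonoid c ℓ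
  ⊙-commutativeMonoid = record { isCommutativeMonoid = ⊙-isCommutativeMonoid }

  open import Algebra.Lattice.Properties.Lattice lattice using (∧-idem; poset)
  open CommutativeMonoid ⊙-commutativeMonoid public
    using (assoc; comm; identityˡ; identityʳ; ∙-congˡ; monoid; commutativeSemigroup)
  open import Algebra.Properties.CommutativeSemigroup commutativeSemigroup public using (interchange)
  open import Algebra.Properties.Monoid.Mult monoid using (×-homo-+) renaming (_×_ to _×ₘ_)

  ≤-refl : ∀ {x} → x ≤ x
  ≤-refl = ∧-idem _

  ≈⇒≤ : ∀ {x y} → x ≈ y → x ≤ y
  ≈⇒≤ x≈y = trans (∧-cong refl (sym x≈y)) (∧-idem _)

  -- poset orders by x ≈ x ∧ y, the symmetric form of x ∧ y ≈ x.
  ≤-trans : ∀ {x y z} → x ≤ y → y ≤ z → x ≤ z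
  ≤-trans x≤y y≤z = sym (Poset.trans poset (sym x≤y) (sym y≤z))

  ≤-antisym : ∀ {x y} → x ≤ y → y ≤ x → x ≈ y
  ≤-antisym x≤y y≤x = Poset.antisym poset (sym x≤y) (sym y≤x)

  ⊙-monoˡ : ∀ {x y} z → x ≤ y → x ⊙ z ≤ y ⊙ z
  ⊙-monoˡ {x} {y} z x≤y = residuation₁ x z (y ⊙ z) (≤-trans x≤y (residuation₂ y z (y ⊙ z) ≤-refl))

  ⊙-mono : ∀ {x y u v} → x ≤ y → u ≤ v → x ⊙ u ≤ y ⊙ v
  ⊙-mono {x} {y} {u} {v} x≤y u≤v =
    ≤-trans (⊙-monoˡ u x≤y)
      (≤-trans (≈⇒≤ (comm y u)) (≤-trans (⊙-monoˡ y u≤v) (≈⇒≤ (comm v y))))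

  ⇒-⊙-≤ : ∀ x y → (x ⇒ y) ⊙ x ≤ y
  ⇒-⊙-≤ x y = residuation₁ (x ⇒ y) x y ≤-refl

  infixr 8 _^_
  _^_ : Carrier → ℕ → Carrier
  x ^ n = n ×ₘ x

  ^-homo-+ : ∀ x m n → x ^ (m + n) ≈ x ^ m ⊙ x ^ n
  ^-homo-+ x m n = ×-homo-+ x m n

  Ds-1 : Ds A 1#
  Ds-1 = ≤-antisym (≤-trans (≈⇒≤ (sym (identityʳ _))) (⇒-⊙-≤ 1# 0#)) (0-least _)

  Ds-⊙ : ∀ {x y} → Ds A x → Ds A y → Ds A (x ⊙ y)
  Ds-⊙ {x} {y} ¬x≈0 ¬y≈0 = ≤-antisym ¬xy≤0 (0-least _)
    where
    ¬xy≤0 : ¬′ (x ⊙ y) ≤ 0#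
    ¬xy≤0 = ≤-trans (residuation₂ _ x 0#
              (≤-trans (residuation₂ _ y 0#
                (≤-trans (≈⇒≤ (assoc _ x y)) (⇒-⊙-≤ (x ⊙ y) 0#)))
                (≈⇒≤ ¬y≈0)))
              (≈⇒≤ ¬x≈0)

  Ds-^ : ∀ {x} → Ds A x → ∀ n → Ds A (x ^ n)
  Ds-^ ¬x≈0 zero    = Ds-1
  Ds-^ ¬x≈0 (suc n) = Ds-⊙ ¬x≈0 (Ds-^ ¬x≈0 n)

  ⊙-Ds-≤0⇒≤0 : ∀ {x y} → Ds A y → x ⊙ y ≤ 0# → x ≤ 0#
  ⊙-Ds-≤0⇒≤0 {x} {y} ¬y≈0 xy≤0 = ≤-trans (residuation₂ x y 0# xy≤0) (≈⇒≤ ¬y≈0)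

module Filters {c ℓ : Level} (A : ResiduatedLattice c ℓ) where
  open ResiduatedLattice A
  open IsEquivalence isEquivalence using (trans)
  open Properties A
  open IsFilter

  1∈ : ∀ {F} → IsFilter A F → F 1#
  1∈ F-filter = up-closed F-filter _ _ (proj₂ (nonempty F-filter)) (1-greatest _)

  ≈-closed : ∀ {F} → IsFilter A F → ∀ {x y} → F x → x ≈ y → F y
  ≈-closed F-filter Fx x≈y = up-closed F-filter _ _ Fx (≈⇒≤ x≈y)

  ^∈ : ∀ {F} → IsFilter A F → ∀ {x} → F x → ∀ n → F (x ^ n)
  ^∈ F-filter Fx zero    = 1∈ F-filter
  ^∈ F-filter Fx (suc n) = ⊙-closed F-filter _ _ Fx (^∈ F-filter Fx n)

  ⟨_,_⟩ : Subset A → Carrier → Subset A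
  ⟨ F , x ⟩ y = ∃₂ λ f n → F f × f ⊙ x ^ n ≤ y

  ⟨,⟩-isFilter : ∀ {F} → IsFilter A F → ∀ x → IsFilter A ⟨ F , x ⟩
  ⟨,⟩-isFilter {F} F-filter x = record
    { nonempty  = 1# , 1# , 0 , 1∈ F-filter , ≈⇒≤ (identityʳ 1#)
    ; ⊙-closed  = ⊙-closed′
    ; up-closed = λ { _ _ (f , n , Ff , fxⁿ≤y) y≤z → f , n , Ff , ≤-trans fxⁿ≤y y≤z }
    }
    where
    ⊙-closed′ : ∀ y z → ⟨ F , x ⟩ y → ⟨ F , x ⟩ z → ⟨ F , x ⟩ (y ⊙ z)
    ⊙-closed′ _ _ (f , m , Ff , fxᵐ≤y) (g , n , Fg , gxⁿ≤z) =
      f ⊙ g , m + n , ⊙-closed F-filter f g Ff Fg ,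
      ≤-trans (≈⇒≤ (trans (∙-congˡ (^-homo-+ x m n)) (interchange f g (x ^ m) (x ^ n))))
              (⊙-mono fxᵐ≤y gxⁿ≤z)

  -- Constructive half of the usual membership criterion for maximal filters.
  maximal-∋ : ∀ {F} → IsMaximalFilter A F → ∀ x
    → (∀ f n → F f → f ⊙ x ^ n ≤ 0# → ⊥) → F x
  maximal-∋ {F} F-maximal x never-0 =
    IsMaximalFilter.maximal F-maximal ⟨ F , x ⟩ (⟨,⟩-isFilter F-filter x)
      (λ { (f , n , Ff , fxⁿ≤0) → never-0 f n Ff fxⁿ≤0 })
      (λ f Ff → f , 0 , Ff , ≈⇒≤ (identityʳ f))
      x (1# , 1 , 1∈ F-filter , ≈⇒≤ (trans (identityˡ _) (identityʳ x)))
    where F-filter = IsMaximalFilter.filter F-maximal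

  Ds⊆Rad : ∀ x → Ds A x → Rad A x
  Ds⊆Rad x ¬x≈0 F F-maximal = maximal-∋ F-maximal x λ f n Ff fxⁿ≤0 →
    IsMaximalFilter.proper F-maximal
      (up-closed (IsMaximalFilter.filter F-maximal) f 0# Ff (⊙-Ds-≤0⇒≤0 (Ds-^ ¬x≈0 n) fxⁿ≤0))

record IsHomomorphism {a b ℓa ℓb : Level} (A : ResiduatedLattice a ℓa) (B : ResiduatedLattice b ℓb)
  (h : ResiduatedLattice.Carrier A → ResiduatedLattice.Carrier B) : Set (a ⊔ ℓa ⊔ ℓb) where
  private
    module A = ResiduatedLattice A
    module B = ResiduatedLattice B
  field
    cong   : ∀ {x y} → x A.≈ y → h x B.≈ h y
    ∨-homo : ∀ x y → h (x A.∨ y) B.≈ h x B.∨ h y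
    ∧-homo : ∀ x y → h (x A.∧ y) B.≈ h x B.∧ h y
    ⊙-homo : ∀ x y → h (x A.⊙ y) B.≈ h x B.⊙ h y
    ⇒-homo : ∀ x y → h (x A.⇒ y) B.≈ h x B.⇒ h y
    0-homo : h A.0# B.≈ B.0#
    1-homo : h A.1# B.≈ B.1#

-- A's levels have the form b ⊔ a, ℓb ⊔ ℓa so that preimages of subsets of B lift to subsets of A.
module Homomorphism {a b ℓa ℓb : Level}
  {A : ResiduatedLattice (b ⊔ a) (ℓb ⊔ ℓa)} {B : ResiduatedLattice b ℓb}
  {h : ResiduatedLattice.Carrier A → ResiduatedLattice.Carrier B}
  (h-homo : IsHomomorphism A B h) where
  private
    module A = ResiduatedLattice A
    module B = ResiduatedLattice B
    module PA = Properties A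
    module PB = Properties B
    module FA = Filters A
    module FB = Filters B
    module BE = IsEquivalence B.isEquivalence
  open IsHomomorphism h-homo

  ≤-homo : ∀ {x y} → x A.≤ y → h x B.≤ h y
  ≤-homo x≤y = BE.trans (BE.sym (∧-homo _ _)) (cong x≤y)

  ^-homo : ∀ x n → h (x PA.^ n) B.≈ h x PB.^ n
  ^-homo x zero    = 1-homo
  ^-homo x (suc n) = BE.trans (⊙-homo x (x PA.^ n)) (PB.∙-congˡ (^-homo x n))

  ¬-homo : ∀ x → h (A.¬′ x) B.≈ B.¬′ h x
  ¬-homo x = BE.trans (⇒-homo x A.0#) (B.⇒-cong BE.refl 0-homo)

  preimage : Subset B → Subset A
  preimage F x = Lift (a ⊔ ℓa) (F (h x))

  preimage-isFilter : ∀ {F} → IsFilter B F → IsFilter A (preimage F)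
  preimage-isFilter F-filter = record
    { nonempty  = A.1# , lift (FB.≈-closed F-filter (FB.1∈ F-filter) (BE.sym 1-homo))
    ; ⊙-closed  = λ x y Fhx Fhy → lift (FB.≈-closed F-filter
        (IsFilter.⊙-closed F-filter _ _ (lower Fhx) (lower Fhy)) (BE.sym (⊙-homo x y)))
    ; up-closed = λ x y Fhx x≤y → lift (IsFilter.up-closed F-filter _ _ (lower Fhx) (≤-homo x≤y))
    }

  preimage-isMaximalFilter : ∀ {F} → IsMaximalFilter B F → IsMaximalFilter A (preimage F)
  preimage-isMaximalFilter {F} F-maximal = record
    { filter  = preimage-isFilter F-filter
    ; proper  = λ Fh0 → IsMaximalFilter.proper F-maximal (FB.≈-closed F-filter (lower Fh0) 0-homo)
    ; maximal = λ G G-filter G-proper F⊆G x Gx → lift (FB.maximal-∋ F-maximal (h x)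
        λ f n Ff fhxⁿ≤0 → G-proper (0∈G G-filter F⊆G x n Gx
          (IsFilter.up-closed F-filter _ _ Ff (B.residuation₂ f _ B.0# fhxⁿ≤0))))
    }
    where
    F-filter = IsMaximalFilter.filter F-maximal
    -- If ¬(h x)ⁿ lies in F, then ¬(xⁿ) lies in G together with xⁿ, so G is improper.
    0∈G : ∀ {G} → IsFilter A G → _⊆_ A (preimage F) G → ∀ x n → G x
      → F (h x PB.^ n B.⇒ B.0#) → G A.0#
    0∈G G-filter F⊆G x n Gx F¬hxⁿ = IsFilter.up-closed G-filter _ _
      (IsFilter.⊙-closed G-filter _ _
        (F⊆G _ (lift (FB.≈-closed F-filter F¬hxⁿ
          (BE.sym (BE.trans (¬-homo (x PA.^ n)) (B.⇒-cong (^-homo x n) BE.refl))))))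
        (FA.^∈ G-filter Gx n))
      (PA.⇒-⊙-≤ (x PA.^ n) A.0#)

  Rad-homo : ∀ x → Rad A x → Rad B (h x)
  Rad-homo x x∈Rad F F-maximal = lower (x∈Rad (preimage F) (preimage-isMaximalFilter F-maximal))

radicalDense-reflected : ∀ {i a b ℓa ℓb} {I : Set i}
  {A : ResiduatedLattice (b ⊔ a) (ℓb ⊔ ℓa)} {B : I → ResiduatedLattice b ℓb}
  (h : ∀ j → ResiduatedLattice.Carrier A → ResiduatedLattice.Carrier (B j))
  → (∀ j → IsHomomorphism A (B j) (h j))
  → (∀ {x y} → (∀ j → ResiduatedLattice._≈_ (B j) (h j x) (h j y)) → ResiduatedLattice._≈_ A x y)
  → (∀ j → RadicalDense (B j)) → RadicalDense A
radicalDense-reflected {a = a} {ℓa = ℓa} {A = A} {B} h h-homo h-jointlyInjective B-radicalDense =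
  Rad⊆Ds , Filters.Ds⊆Rad A
  where
  Rad⊆Ds : ∀ x → Rad A x → Ds A x
  Rad⊆Ds x x∈Rad = h-jointlyInjective λ j →
    let open ResiduatedLattice (B j) using (isEquivalence)
        open IsEquivalence isEquivalence using (trans; sym)
        open Homomorphism {a = a} {ℓa = ℓa} (h-homo j)
    in trans (¬-homo x)
         (trans (proj₁ (B-radicalDense j) (h j x) (Rad-homo x x∈Rad))
                (sym (IsHomomorphism.0-homo (h-homo j))))

proj₁-isHomomorphism : ∀ {c ℓ s} (A : ResiduatedLattice c ℓ) (S : Subalgebra s A)
  → IsHomomorphism (subalgebra A S) A proj₁
proj₁-isHomomorphism A S = record
  { cong   = λ x≈y → x≈y
  ; ∨-homo = λ _ _ → refl
  ; ∧-homo = λ _ _ → refl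
  ; ⊙-homo = λ _ _ → refl
  ; ⇒-homo = λ _ _ → refl
  ; 0-homo = refl
  ; 1-homo = refl
  }
  where open IsEquivalence (ResiduatedLattice.isEquivalence A) using (refl)

projection-isHomomorphism : ∀ {i c ℓ} (I : Set i) (A : I → ResiduatedLattice c ℓ) (j : I)
  → IsHomomorphism (product I A) (A j) (λ x → x j)
projection-isHomomorphism I A j = record
  { cong   = λ x≈y → x≈y j
  ; ∨-homo = λ _ _ → refl
  ; ∧-homo = λ _ _ → refl
  ; ⊙-homo = λ _ _ → refl
  ; ⇒-homo = λ _ _ → refl
  ; 0-homo = refl
  ; 1-homo = refl
  }
  where open IsEquivalence (ResiduatedLattice.isEquivalence (A j)) using (refl)

proposition4p5 : ∀ {c ℓ s i}
    → ((A : ResiduatedLattice c ℓ) (B : Subalgebra s A)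
    → RadicalDense A → RadicalDense (subalgebra A B))
    × ((I : Set i) (A : I → ResiduatedLattice c ℓ)
    → (∀ j → RadicalDense (A j)) → RadicalDense (product I A))
proposition4p5 {ℓ = ℓ} {s} {i} =
  (λ A S A-radicalDense → radicalDense-reflected {a = s} {ℓa = ℓ} {I = ⊤}
     (λ _ → proj₁) (λ _ → proj₁-isHomomorphism A S) (λ agree → agree tt) (λ _ → A-radicalDense))
  , (λ I A A-radicalDense → radicalDense-reflected {a = i} {ℓa = i}
     (λ j x → x j) (projection-isHomomorphism I A) (λ agree → agree) A-radicalDense)
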